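{- Let $G$ be a finite connected graph on $n$ vertices and $k\geq 1$ an integer, and let $\mathcal{E}_k$ be the scramble on $G$ whose eggs are exactly the connected subsets of $V(G)$ with exactly $k$ vertices. Then $h(\mathcal{E}_k)=n-\alpha_{k-1}^c(G)$.
   Context: Graphs are finite, connected, undirected multigraphs without loops. A set $S\subseteq V(G)$ is connected if $G[S]$ is connected. For $j\geq 0$, $\alpha_j^c(G)$ is the maximum size of a set $S\subseteq V(G)$ such that every connected component of the induced subgraph $G[S]$ has at most $j$ vertices (so $\alpha_0^c(G)=0$). A scramble is a collection of nonempty connected subsets (eggs); a hitting set is a set $C\subseteq V(G)$ meeting every egg, and $h(\mathcal{S})$ is the minimum size of a hitting set. -}

module Defs where

open import Data.Nat using (ℕ; _≤_; _≡ᵇ_)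
open import Data.Fin using (Fin)
open import Data.Fin.Subset using (Subset; _∈_; ∣_∣; ⊤)
open import Data.Product using (Σ; _×_; ∃)
open import Relation.Binary.PropositionalEquality using (_≡_)

record Multigraph (n : ℕ) : Set where
  field
    mult     : Fin n → Fin n → ℕ
    symm     : ∀ u v → mult u v ≡ mult v u
    loopless : ∀ v → mult v v ≡ 0

open Multigraph public

Adj : ∀ {n} → Multigraph n → Fin n → Fin n → Set
Adj G u v = 1 ≤ mult G u v

data Reach {n} (G : Multigraph n) (S : Subset n) : Fin n → Fin n → Set where
  here : ∀ {u} → u ∈ S → Reach G S u u
  step : ∀ {u v w} → u ∈ S → Adj G u v → Reach G S v w → Reach G S u w

ConnectedSet : ∀ {n} → Multigraph n → Subset n → Set
ConnectedSet G S = ∀ u v → u ∈ S → v ∈ S → Reach G S u v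

ConnectedGraph : ∀ {n} → Multigraph n → Set
ConnectedGraph G = ConnectedSet G ⊤

-- Every connected component of G[S] has at most j vertices:
-- for every u ∈ S, every set of vertices reachable from u in G[S]
-- (in particular the component of u) has at most j elements.
ComponentsAtMost : ∀ {n} → Multigraph n → ℕ → Subset n → Set
ComponentsAtMost {n} G j S =
  ∀ u → u ∈ S → (T : Subset n) → (∀ v → v ∈ T → Reach G S u v) → ∣ T ∣ ≤ j

IsAlphaC : ∀ {n} → Multigraph n → ℕ → ℕ → Set
IsAlphaC {n} G j a =
  Σ (Subset n) (λ S → ComponentsAtMost G j S × ∣ S ∣ ≡ a)
  × (∀ S → ComponentsAtMost G j S → ∣ S ∣ ≤ a)

EggEk : ∀ {n} → Multigraph n → ℕ → Subset n → Set
EggEk G k E = ConnectedSet G E × ∣ E ∣ ≡ k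

HittingEk : ∀ {n} → Multigraph n → ℕ → Subset n → Set
HittingEk G k C = ∀ E → EggEk G k E → ∃ λ v → v ∈ C × v ∈ E

IsHittingNumberEk : ∀ {n} → Multigraph n → ℕ → ℕ → Set
IsHittingNumberEk {n} G k m =
  Σ (Subset n) (λ C → HittingEk G k C × ∣ C ∣ ≡ m)
  × (∀ C → HittingEk G k C → m ≤ ∣ C ∣)

{-# OPTIONS --safe #-}
-- A set S has all components of G[S] of size at most k − 1 exactly when it
-- contains no connected k-set, since a component with at least k vertices can
-- be grown one adjacent vertex at a time into a connected k-set. So C hits
-- every egg of E_k iff its complement has this property, and complementation
-- turns a minimum hitting set into a maximum such set.
module Submission where

open import Defs
open import Data.Nat using (ℕ; zero; suc; _+_; _∸_; _≤_; z≤n; _≤?_; _≟_)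
open import Data.Nat.Properties
  using (≤-trans; ≤∧≢⇒<; ≤-pred; +-identityʳ; +-suc; m+1+n≰m; 1+n≰n; ≰⇒>; ∸-monoʳ-≤; m∸[m∸n]≡n; module ≤-Reasoning)
open import Data.Fin using (Fin; zero; suc)
open import Data.Fin.Properties using (any?)
open import Data.Fin.Subset
open import Data.Fin.Subset.Properties
open import Data.Vec using (_∷_; here; there)
open import Data.Product using (Σ; _×_; _,_; ∃)
open import Data.Sum using (_⊎_; inj₁; inj₂)
open import Data.Unit using (tt) renaming (⊤ to Unit)
open import Function using (_∘_)
open import Level using (Level)
open import Relation.Nullary using (¬_; Dec; yes; no; contradiction)
open import Relation.Nullary.Decidable using (_×-dec_; ¬?; decidable-stable)
open import Relation.Unary using (Pred; Decidable)
open import Relation.Binary.PropositionalEquality using (_≡_; refl; sym; trans; cong; subst; module ≡-Reasoning)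

private variable
  ℓ : Level
  n : ℕ
  p q : Subset n
  x y : Fin n

∣p∪⁅x⁆∣≡1+∣p∣ : ∀ (p : Subset n) x → x ∉ p → ∣ p ∪ ⁅ x ⁆ ∣ ≡ suc ∣ p ∣
∣p∪⁅x⁆∣≡1+∣p∣ (inside  ∷ p) zero    x∉p = contradiction here x∉p
∣p∪⁅x⁆∣≡1+∣p∣ (outside ∷ p) zero    x∉p = cong (λ q → suc ∣ q ∣) (∪-identityʳ p)
∣p∪⁅x⁆∣≡1+∣p∣ (inside  ∷ p) (suc x) x∉p = cong suc (∣p∪⁅x⁆∣≡1+∣p∣ p x (x∉p ∘ there))
∣p∪⁅x⁆∣≡1+∣p∣ (outside ∷ p) (suc x) x∉p = ∣p∪⁅x⁆∣≡1+∣p∣ p x (x∉p ∘ there)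

∣p∣≡1+m⇒Nonempty : ∀ {p : Subset n} {m} → ∣ p ∣ ≡ suc m → Nonempty p
∣p∣≡1+m⇒Nonempty {p = inside  ∷ p} _   = zero , here
∣p∣≡1+m⇒Nonempty {p = outside ∷ p} ∣p∣≡ with ∣p∣≡1+m⇒Nonempty {p = p} ∣p∣≡
... | x , x∈p = suc x , there x∈p

x∈p∪⁅y⁆⁻ : ∀ (p : Subset n) y → x ∈ p ∪ ⁅ y ⁆ → x ∈ p ⊎ x ≡ y
x∈p∪⁅y⁆⁻ p y x∈p∪⁅y⁆ with x∈p∪q⁻ p ⁅ y ⁆ x∈p∪⁅y⁆
... | inj₁ x∈p   = inj₁ x∈p
... | inj₂ x∈⁅y⁆ = inj₂ (x∈⁅y⁆⇒x≡y y x∈⁅y⁆)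

p⊆q⇒p∪⁅y⁆⊆q : p ⊆ q → y ∈ q → p ∪ ⁅ y ⁆ ⊆ q
p⊆q⇒p∪⁅y⁆⊆q {p = p} {y = y} p⊆q y∈q x∈ with x∈p∪⁅y⁆⁻ p y x∈
... | inj₁ x∈p  = p⊆q x∈p
... | inj₂ refl = y∈q

x∈p⇒⁅x⁆⊆p : x ∈ p → ⁅ x ⁆ ⊆ p
x∈p⇒⁅x⁆⊆p {x = x} x∈p y∈⁅x⁆ with x∈⁅y⁆⇒x≡y x y∈⁅x⁆
... | refl = x∈p

p⊈q⇒∃∈∉ : ¬ p ⊆ q → ∃ λ x → x ∈ p × x ∉ q
p⊈q⇒∃∈∉ {p = p} {q = q} p⊈q with any? (λ x → (x ∈? p) ×-dec ¬? (x ∈? q))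
... | yes witness = witness
... | no  none    = contradiction
  (λ {x} x∈p → decidable-stable (x ∈? q) (λ x∉q → none (x , x∈p , x∉q))) p⊈q

module _ {P : Pred (Subset n) ℓ} (P? : Decidable P) where

  MaximumCard : Set ℓ
  MaximumCard = ∃ λ S → P S × (∀ T → P T → ∣ T ∣ ≤ ∣ S ∣)

  maximumCard-below : ∃ P → ∀ c → (∀ T → P T → ∣ T ∣ ≤ c) → MaximumCard
  maximumCard-below (S , PS) zero    ≤0 = S , PS , λ T PT → ≤-trans (≤0 T PT) z≤n
  maximumCard-below witness  (suc c) ≤c
    with anySubset? (λ S → P? S ×-dec (∣ S ∣ ≟ suc c))
  ... | yes (S , PS , ∣S∣≡) = S , PS , λ T PT → subst (∣ T ∣ ≤_) (sym ∣S∣≡) (≤c T PT)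
  ... | no  none            = maximumCard-below witness c λ T PT →
          ≤-pred (≤∧≢⇒< (≤c T PT) (λ ∣T∣≡ → none (T , PT , ∣T∣≡)))

  maximumCard : ∃ P → MaximumCard
  maximumCard witness = maximumCard-below witness n (λ T _ → ∣p∣≤n T)

module _ (G : Multigraph n) where

  private variable
    S T E : Subset n
    u v w : Fin n

  Adj-sym : Adj G u v → Adj G v u
  Adj-sym {u} {v} = subst (1 ≤_) (symm G u v)

  Adj? : ∀ u v → Dec (Adj G u v)
  Adj? u v = 1 ≤? mult G u v

  Reach⇒source∈ : Reach G S u v → u ∈ S
  Reach⇒source∈ (here u∈S)     = u∈S
  Reach⇒source∈ (step u∈S _ _) = u∈S

  Reach-mono : S ⊆ T → Reach G S u v → Reach G T u v
  Reach-mono S⊆T (here u∈S)         = here (S⊆T u∈S)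
  Reach-mono S⊆T (step u∈S uv walk) = step (S⊆T u∈S) uv (Reach-mono S⊆T walk)

  Reach-snoc : Reach G S u v → Adj G v w → w ∈ S → Reach G S u w
  Reach-snoc (here u∈S)          uw w∈S = step u∈S uw (here w∈S)
  Reach-snoc (step u∈S uv' walk) vw w∈S = step u∈S uv' (Reach-snoc walk vw w∈S)

  ⁅u⁆-connected : ∀ u → ConnectedSet G ⁅ u ⁆
  ⁅u⁆-connected u v w v∈ w∈ with x∈⁅y⁆⇒x≡y u v∈ | x∈⁅y⁆⇒x≡y u w∈
  ... | refl | refl = here v∈

  ∪⁅⁆-connected : ConnectedSet G E → u ∈ E → Adj G u v → ConnectedSet G (E ∪ ⁅ v ⁆)
  ∪⁅⁆-connected {E} {u} {v} E-conn u∈E uv a b a∈ b∈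
    with x∈p∪⁅y⁆⁻ E v a∈ | x∈p∪⁅y⁆⁻ E v b∈
  ... | inj₁ a∈E | inj₁ b∈E = Reach-mono (p⊆p∪q ⁅ v ⁆) (E-conn a b a∈E b∈E)
  ... | inj₁ a∈E | inj₂ refl = Reach-snoc (Reach-mono (p⊆p∪q ⁅ v ⁆) (E-conn a u a∈E u∈E)) uv b∈
  ... | inj₂ refl | inj₁ b∈E = step a∈ (Adj-sym uv) (Reach-mono (p⊆p∪q ⁅ v ⁆) (E-conn u b u∈E b∈E))
  ... | inj₂ refl | inj₂ refl = here a∈

  Frontier : Subset n → Subset n → Fin n → Set
  Frontier S E v = v ∉ E × v ∈ S × ∃ λ u → u ∈ E × Adj G u v

  frontier? : ∀ S E → Decidable (Frontier S E)
  frontier? S E v = ¬? (v ∈? E) ×-dec (v ∈? S) ×-dec any? (λ u → (u ∈? E) ×-dec Adj? u v)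

  Reach⇒frontier : Reach G S u w → u ∈ E → w ∉ E → ∃ (Frontier S E)
  Reach⇒frontier (here _) u∈E w∉E = contradiction u∈E w∉E
  Reach⇒frontier {E = E} (step {v = v} _ uv walk) u∈E w∉E with v ∈? E
  ... | yes v∈E = Reach⇒frontier walk v∈E w∉E
  ... | no  v∉E = v , v∉E , Reach⇒source∈ walk , _ , u∈E , uv

  -- Unlike connectedness of a set, growth is decidable, which makes
  -- ComponentsAtMost decidable and so lets α^c be found by finite search.
  Growth : Subset n → Subset n → ℕ → Set
  Growth S E zero    = Unit
  Growth S E (suc m) = ∃ λ v → Frontier S E v × Growth S (E ∪ ⁅ v ⁆) m

  growth? : ∀ S E m → Dec (Growth S E m)
  growth? S E zero    = yes tt
  growth? S E (suc m) = any? (λ v → frontier? S E v ×-dec growth? S (E ∪ ⁅ v ⁆) m)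

  growth⇒connected : ∀ m → E ⊆ S → ConnectedSet G E → Growth S E m →
    ∃ λ E′ → E′ ⊆ S × ConnectedSet G E′ × ∣ E′ ∣ ≡ ∣ E ∣ + m
  growth⇒connected {E} zero E⊆S E-conn _ = E , E⊆S , E-conn , sym (+-identityʳ ∣ E ∣)
  growth⇒connected {E} (suc m) E⊆S E-conn (v , (v∉E , v∈S , u , u∈E , uv) , grow)
    with growth⇒connected m (p⊆q⇒p∪⁅y⁆⊆q E⊆S v∈S) (∪⁅⁆-connected E-conn u∈E uv) grow
  ... | E′ , E′⊆S , E′-conn , ∣E′∣≡ = E′ , E′⊆S , E′-conn , (begin
      ∣ E′ ∣              ≡⟨ ∣E′∣≡ ⟩
      ∣ E ∪ ⁅ v ⁆ ∣ + m   ≡⟨ cong (_+ m) (∣p∪⁅x⁆∣≡1+∣p∣ E v v∉E) ⟩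
      suc (∣ E ∣ + m)     ≡⟨ sym (+-suc ∣ E ∣ m) ⟩
      ∣ E ∣ + suc m       ∎)
    where open ≡-Reasoning

  reachable⇒growth : (∀ v → v ∈ T → Reach G S u v) →
    ∀ m → u ∈ E → ∣ E ∣ + m ≤ ∣ T ∣ → Growth S E m
  reachable⇒growth reach zero    u∈E size = tt
  reachable⇒growth {T} {E = E} reach (suc m) u∈E size with T ⊆? E
  ... | yes T⊆E = contradiction (≤-trans size (p⊆q⇒∣p∣≤∣q∣ T⊆E)) (m+1+n≰m ∣ E ∣)
  ... | no  T⊈E with p⊈q⇒∃∈∉ T⊈E
  ... | w , w∈T , w∉E with Reach⇒frontier (reach w w∈T) u∈E w∉E
  ... | v , v∈frontier@(v∉E , _) =
    v , v∈frontier , reachable⇒growth reach m (p⊆p∪q ⁅ v ⁆ u∈E)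
      (subst (_≤ ∣ T ∣) (trans (+-suc ∣ E ∣ m) (cong (_+ m) (sym (∣p∪⁅x⁆∣≡1+∣p∣ E v v∉E)))) size)

  EggFree : ℕ → Subset n → Set
  EggFree k S = ∀ E → E ⊆ S → ¬ EggEk G k E

  componentsAtMost⇒eggFree : ∀ {j} → ComponentsAtMost G j S → EggFree (suc j) S
  componentsAtMost⇒eggFree small E E⊆S (E-conn , ∣E∣≡) with ∣p∣≡1+m⇒Nonempty ∣E∣≡
  ... | u , u∈E = 1+n≰n (subst (_≤ _) ∣E∣≡
    (small u (E⊆S u∈E) E (λ v v∈E → Reach-mono E⊆S (E-conn u v u∈E v∈E))))

  growth⇒¬eggFree : ∀ j → u ∈ S → Growth S ⁅ u ⁆ j → ¬ EggFree (suc j) S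
  growth⇒¬eggFree {u} j u∈S grow eggFree
    with growth⇒connected j (x∈p⇒⁅x⁆⊆p u∈S) (⁅u⁆-connected u) grow
  ... | E , E⊆S , E-conn , ∣E∣≡ = eggFree E E⊆S (E-conn , trans ∣E∣≡ (cong (_+ j) (∣⁅x⁆∣≡1 u)))

  ¬growth⇒componentsAtMost : ∀ j → (∀ u → u ∈ S → ¬ Growth S ⁅ u ⁆ j) → ComponentsAtMost G j S
  ¬growth⇒componentsAtMost j noGrowth u u∈S T reach with ∣ T ∣ ≤? j
  ... | yes ∣T∣≤j = ∣T∣≤j
  ... | no  ∣T∣≰j = contradiction (reachable⇒growth reach j (x∈⁅x⁆ u)
          (subst (_≤ ∣ T ∣) (cong (_+ j) (sym (∣⁅x⁆∣≡1 u))) (≰⇒> ∣T∣≰j)))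
        (noGrowth u u∈S)

  eggFree⇒componentsAtMost : ∀ j → EggFree (suc j) S → ComponentsAtMost G j S
  eggFree⇒componentsAtMost j eggFree =
    ¬growth⇒componentsAtMost j (λ u u∈S grow → growth⇒¬eggFree j u∈S grow eggFree)

  componentsAtMost? : ∀ j → Decidable (ComponentsAtMost G j)
  componentsAtMost? j S with any? (λ u → (u ∈? S) ×-dec growth? S ⁅ u ⁆ j)
  ... | yes (u , u∈S , grow) = no (growth⇒¬eggFree j u∈S grow ∘ componentsAtMost⇒eggFree)
  ... | no  none             = yes (¬growth⇒componentsAtMost j (λ u u∈S grow → none (u , u∈S , grow)))

  ⊥-componentsAtMost : ∀ j → ComponentsAtMost G j ⊥
  ⊥-componentsAtMost j u u∈⊥ = contradiction u∈⊥ ∉⊥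

  hitting⇒eggFree-∁ : ∀ {k C} → HittingEk G k C → EggFree k (∁ C)
  hitting⇒eggFree-∁ hitting E E⊆∁C egg with hitting E egg
  ... | v , v∈C , v∈E = x∈∁p⇒x∉p (E⊆∁C v∈E) v∈C

  eggFree⇒hitting-∁ : ∀ {k} → EggFree k S → HittingEk G k (∁ S)
  eggFree⇒hitting-∁ {S} eggFree E egg with E ⊆? S
  ... | yes E⊆S = contradiction egg (eggFree E E⊆S)
  ... | no  E⊈S with p⊈q⇒∃∈∉ E⊈S
  ... | v , v∈E , v∉S = v , x∉p⇒x∈∁p v∉S , v∈E

lemma3p2 : ∀ {n} (G : Multigraph n) → ConnectedGraph G → (k : ℕ) → 1 ≤ k →
    Σ ℕ (λ a → IsAlphaC G (k ∸ 1) a × IsHittingNumberEk G k (n ∸ a))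
lemma3p2 {n} G _ (suc j) _
  with maximumCard (componentsAtMost? G j) (⊥ , ⊥-componentsAtMost G j)
... | S , S-small , S-max =
  ∣ S ∣ , ((S , S-small , refl) , S-max) ,
  (∁ S , eggFree⇒hitting-∁ G (componentsAtMost⇒eggFree G S-small) , ∣∁p∣≡n∸∣p∣ S) , minimal
  where
  open ≤-Reasoning
  minimal : ∀ C → HittingEk G (suc j) C → n ∸ ∣ S ∣ ≤ ∣ C ∣
  minimal C hitting = begin
    n ∸ ∣ S ∣         ≤⟨ ∸-monoʳ-≤ n (S-max (∁ C) ∁C-small) ⟩
    n ∸ ∣ ∁ C ∣       ≡⟨ cong (n ∸_) (∣∁p∣≡n∸∣p∣ C) ⟩
    n ∸ (n ∸ ∣ C ∣)   ≡⟨ m∸[m∸n]≡n (∣p∣≤n C) ⟩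
    ∣ C ∣             ∎
    where
    ∁C-small : ComponentsAtMost G j (∁ C)
    ∁C-small = eggFree⇒componentsAtMost G j (hitting⇒eggFree-∁ G hitting)
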